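{- Let $F$ be a graph with $\ell\ge2$ vertices. Then $$E[F]\ge\left\lfloor\tfrac12\,\ell-2\log_2\ell+3\right\rfloor.$$
   Context: Graphs are finite, simple, undirected, loopless. For $k\ge2$, a graph $G$ has the $k$-extension property (satisfies the $k$th extension axiom $\mathrm{EA}_k$) if for every two disjoint sets $X,Y\subseteq V(G)$ with $|X\cup Y|<k$ there is a vertex $z\notin X\cup Y$ adjacent to all vertices of $X$ and non-adjacent to all vertices of $Y$; $\mathrm{EA}_1$ just says the graph is non-empty. Write $F\sqsubset H$ if $H$ contains an induced subgraph isomorphic to $F$. For a graph $F$ with more than one vertex, the extension index $E[F]$ is the minimum $k$ such that every graph $H$ satisfying $\mathrm{EA}_k$ has $F\sqsubset H$ (equivalently, the maximum $k$ for which some graph $H$ satisfies $\mathrm{EA}_{k-1}$ and $F\not\sqsubset H$). -}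

module Defs where

open import Data.Nat using (ℕ; _<_; _+_; _*_; _∸_; _^_)
open import Data.Bool using (Bool; true; false)
open import Data.Fin using (Fin)
open import Data.Fin.Subset using (Subset; _∈_; _∉_; _∪_; ∣_∣)
open import Data.Product using (Σ; ∃; _×_)
open import Function.Definitions using (Injective)
open import Relation.Binary.PropositionalEquality using (_≡_)

record Graph : Set where
  field
    n     : ℕ
    adj   : Fin n → Fin n → Bool
    sym   : ∀ i j → adj i j ≡ adj j i
    loopless : ∀ i → adj i i ≡ false
open Graph public

_⊏_ : Graph → Graph → Set
F ⊏ H = Σ (Fin (n F) → Fin (n H)) λ f →
          Injective _≡_ _≡_ f × (∀ i j → adj H (f i) (f j) ≡ adj F i j)

-- For every two disjoint vertex sets
-- X, Y with |X ∪ Y| < k there is z ∉ X ∪ Y adjacent to all of X and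
-- non-adjacent to all of Y.  (For k = 1 this says exactly that H is non-empty.)
EA : ℕ → Graph → Set
EA k H = (X Y : Subset (n H)) →
         (∀ x → x ∈ X → x ∉ Y) →
         ∣ X ∪ Y ∣ < k →
         ∃ λ z → z ∉ (X ∪ Y) ×
                 (∀ x → x ∈ X → adj H z x ≡ true) ×
                 (∀ y → y ∈ Y → adj H z y ≡ false)

-- k is an admissible value in the definition of the extension index E[F]:
-- every graph satisfying EA_k contains F as an induced subgraph.
-- E[F] is the minimum such k (k ≥ 1).
ForcesF : Graph → ℕ → Set
ForcesF F k = ∀ (H : Graph) → EA k H → F ⊏ H

-- FloorBoundLe ℓ k  expresses  ⌊ ℓ/2 - 2 log₂ ℓ + 3 ⌋ ≤ k  for ℓ ≥ 2.
-- Derivation: ⌊x⌋ ≤ k  ⇔  x < k + 1  ⇔  ℓ/2 + 2 - k < 2 log₂ ℓ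
--   ⇔  2^(ℓ + 4 - 2k) < ℓ^4   (exponentiate base 2, then square).
-- If ℓ + 4 ≤ 2k the left side is ≤ 1 < ℓ^4, which matches truncated
-- subtraction giving 2^0 = 1 < ℓ^4 (true for ℓ ≥ 2).
FloorBoundLe : ℕ → ℕ → Set
FloorBoundLe ℓ k = 2 ^ (ℓ + 4 ∸ 2 * k) < ℓ ^ 4

-- If the bound fails, then ℓ = n F = 2k + D with ℓ⁴ ≤ 2^(D+4), and we exhibit a graph that satisfies
-- EA_k but omits F. Let h = ⌊ℓ/2⌋, so that h⁴ ≤ 2^D, and take the uniform random graph on
-- N = 2^(k-1) h² vertices. Since N² ≤ 2^(ℓ-2), the expected number of induced copies of F, counted
-- as injective ℓ-tuples, is N^ℓ 2^(-ℓ(ℓ-1)/2) ≤ 1/2. An instance of EA_k with |X ∪ Y| = s < k fails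
-- only if each of the N - s other vertices misses its pattern, which has probability
-- (1 - 2^(-s))^(N-s) ≤ 2^(1-h²); as 2k (2N)^(k-1) ≤ 2^(h²-1), the at most (2N)^s instances of size s
-- contribute at most 1/(2k), and all sizes together less than 1/2. So some graph has neither.
-- Expectations are kept in ℕ by summing over all N·N-bit vectors: the bit combine i j with i < j
-- is the edge {i, j}, and the other bits are never read.

module Submission where

open import Defs hiding (sym)
open import Data.Nat using (ℕ; _≤_)
open import Data.Nat using (zero; suc; _+_; _*_; _∸_; _^_; _<_; _<?_; z≤n; s≤s; NonZero; >-nonZero)
open import Data.Nat.Properties
open import Data.Nat.Tactic.RingSolver using (solve-∀)
open import Data.Bool using (Bool; true; false; if_then_else_)
import Data.Bool.Properties as Bool
open import Data.Fin as Fin using (Fin; zero; suc; toℕ; combine)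
open import Data.Fin.Properties as Fin using (combine-injective; toℕ<n)
open import Data.Fin.Subset using (Subset; inside; outside; ⊥; ∁; ∣_∣; _∪_; _∈_; _∉_)
open import Data.Fin.Subset.Properties using (_∈?_; x∈∁p⇒x∉p; x∈p∪q⁺; ∣∁p∣≡n∸∣p∣; ∣⊥∣≡0; ∣p∣≤∣x∷p∣)
open import Data.Vec using (Vec; []; _∷_; lookup; map; tabulate; _++_; _[_]≔_; here; there)
open import Data.Vec.Properties
  using (≡-dec; lookup∘update′; map-++; map-∘; tabulate-∘; tabulate-cong; []≔-updates; []≔-minimal; ∷-injectiveˡ; ∷-injectiveʳ)
open import Data.Vec.Relation.Unary.All as All using (All; []; _∷_)
import Data.Vec.Relation.Unary.All.Properties as All
open import Data.Vec.Relation.Unary.Any as Any using (Any)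
open import Data.Vec.Relation.Unary.AllPairs using (allPairs?)
import Data.Vec.Relation.Unary.AllPairs.Properties as AllPairs
open import Data.Vec.Relation.Unary.Unique.Propositional using (Unique; []; _∷_)
import Data.Vec.Relation.Unary.Unique.Propositional.Properties as Unique
open import Data.Vec.Membership.Propositional using () renaming (_∈_ to _∈ᵥ_)
open import Data.Vec.Membership.Propositional.Properties using (∈-map⁺)
open import Data.Product using (∃; Σ; _×_; _,_; proj₁; proj₂)
open import Data.Sum using (_⊎_; inj₁; inj₂)
open import Function using (_∘_; const)
open import Relation.Nullary using (Dec; does; yes; no; ¬_; ¬?; _×-dec_; contradiction)
open import Relation.Nullary.Decidable using (dec-true; dec-false)
open import Relation.Binary.PropositionalEquality
open import Relation.Binary.Definitions using (DecidableEquality)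
open import Algebra.Properties.Semiring.Sum +-*-semiring
  using (sum-syntax; sum-cong-≗; ∑-distrib-+; *-distribˡ-sum)
open import Algebra.Properties.CommutativeSemigroup +-commutativeSemigroup using (interchange)
open import Algebra.Properties.CommutativeSemigroup *-commutativeSemigroup
  using (x∙yz≈y∙xz; xy∙z≈y∙xz) renaming (interchange to *-interchange)

-- Elementary inequalities

^-distrib-* : ∀ a b n → (a * b) ^ n ≡ a ^ n * b ^ n
^-distrib-* a b zero    = refl
^-distrib-* a b (suc n) = trans (cong (a * b *_) (^-distrib-* a b n)) (*-interchange a b (a ^ n) (b ^ n))

square-cancel-≤ : ∀ {a b} → a * a ≤ b * b → a ≤ b
square-cancel-≤ a²≤b² = ≮⇒≥ (λ b<a → <⇒≱ (*-mono-< b<a b<a) a²≤b²)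

n<2^n : ∀ n → n < 2 ^ n
n<2^n zero    = s≤s z≤n
n<2^n (suc n) = begin-strict
  1 + n          <⟨ +-monoʳ-< 1 (n<2^n n) ⟩
  1 + 2 ^ n      ≤⟨ +-monoˡ-≤ (2 ^ n) (m^n>0 2 n) ⟩
  2 ^ n + 2 ^ n  ≡⟨ cong (2 ^ n +_) (sym (+-identityʳ (2 ^ n))) ⟩
  2 ^ suc n      ∎
  where open ≤-Reasoning

bernoulli : ∀ x n → x ^ n * (x + n) ≤ suc x ^ n * x
bernoulli x zero    = ≤-reflexive (trans (*-identityˡ (x + 0)) (trans (+-identityʳ x) (sym (*-identityˡ x))))
bernoulli x (suc n) = begin
  x * x ^ n * (x + suc n)                 ≤⟨ m≤m+n _ (x ^ n * n) ⟩
  x * x ^ n * (x + suc n) + x ^ n * n     ≡⟨ expand (x ^ n) x n ⟩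
  x ^ n * (x + n) * suc x                 ≤⟨ *-monoˡ-≤ (suc x) (bernoulli x n) ⟩
  suc x ^ n * x * suc x                   ≡⟨ reorder (suc x ^ n) x ⟩
  suc x * suc x ^ n * x                   ∎
  where
  open ≤-Reasoning
  expand : ∀ y x n → x * y * (x + suc n) + y * n ≡ y * (x + n) * suc x
  expand = solve-∀
  reorder : ∀ a x → a * x * suc x ≡ suc x * a * x
  reorder = solve-∀

2*x^[1+x]≤[1+x]^[1+x] : ∀ x → 2 * x ^ suc x ≤ suc x ^ suc x
2*x^[1+x]≤[1+x]^[1+x] zero    = z≤n
2*x^[1+x]≤[1+x]^[1+x] (suc x) = *-cancelˡ-≤ (suc x) (begin
  suc x * (2 * y)                        ≤⟨ m≤m+n _ y ⟩
  suc x * (2 * y) + y                    ≡⟨ expand y x ⟩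
  y * (suc x + suc (suc x))              ≤⟨ bernoulli (suc x) (suc (suc x)) ⟩
  suc (suc x) ^ suc (suc x) * suc x      ≡⟨ *-comm _ (suc x) ⟩
  suc x * suc (suc x) ^ suc (suc x)      ∎)
  where
  open ≤-Reasoning
  y = suc x ^ suc (suc x)
  expand : ∀ y x → suc x * (2 * y) + y ≡ y * (suc x + suc (suc x))
  expand = solve-∀

[q∸1]^R*2^M≤q^R : ∀ q {M R} → 1 ≤ q → q * M ≤ R → (q ∸ 1) ^ R * 2 ^ M ≤ q ^ R
[q∸1]^R*2^M≤q^R (suc x) {M} {R} _ qM≤R = begin
  x ^ R * 2 ^ M                   ≡⟨ cong (λ e → x ^ e * 2 ^ M) (sym R≡qM+r) ⟩
  x ^ (qM + r) * 2 ^ M            ≡⟨ cong (_* 2 ^ M) (^-distribˡ-+-* x qM r) ⟩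
  x ^ qM * x ^ r * 2 ^ M          ≡⟨ xy∙z≈y∙xz (x ^ qM) (x ^ r) (2 ^ M) ⟩
  x ^ r * (x ^ qM * 2 ^ M)        ≤⟨ *-mono-≤ (^-monoˡ-≤ r (n≤1+n x)) halving ⟩
  suc x ^ r * suc x ^ qM          ≡⟨ *-comm (suc x ^ r) _ ⟩
  suc x ^ qM * suc x ^ r          ≡⟨ sym (^-distribˡ-+-* (suc x) qM r) ⟩
  suc x ^ (qM + r)                ≡⟨ cong (suc x ^_) R≡qM+r ⟩
  suc x ^ R                       ∎
  where
  open ≤-Reasoning
  qM = suc x * M
  r  = R ∸ qM
  R≡qM+r : qM + r ≡ R
  R≡qM+r = m+[n∸m]≡n qM≤R
  halving : x ^ qM * 2 ^ M ≤ suc x ^ qM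
  halving = begin
    x ^ qM * 2 ^ M                ≡⟨ cong (_* 2 ^ M) (sym (^-*-assoc x (suc x) M)) ⟩
    (x ^ suc x) ^ M * 2 ^ M       ≡⟨ *-comm _ (2 ^ M) ⟩
    2 ^ M * (x ^ suc x) ^ M       ≡⟨ sym (^-distrib-* 2 (x ^ suc x) M) ⟩
    (2 * x ^ suc x) ^ M           ≤⟨ ^-monoˡ-≤ M (2*x^[1+x]≤[1+x]^[1+x] x) ⟩
    (suc x ^ suc x) ^ M           ≡⟨ ^-*-assoc (suc x) (suc x) M ⟩
    suc x ^ qM                    ∎

[a∸1]*q≤[q∸1]*a : ∀ {a q} → 1 ≤ a → a ≤ q → (a ∸ 1) * q ≤ (q ∸ 1) * a
[a∸1]*q≤[q∸1]*a {suc a} {q} _ a<q = begin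
  a * q                 ≡⟨ cong (a *_) (sym q≡1+a+c) ⟩
  a * (suc a + c)       ≤⟨ m≤m+n _ c ⟩
  a * (suc a + c) + c   ≡⟨ expand a c ⟩
  (a + c) * suc a       ≡⟨ cong (λ q → (q ∸ 1) * suc a) q≡1+a+c ⟩
  (q ∸ 1) * suc a       ∎
  where
  open ≤-Reasoning
  c = q ∸ suc a
  q≡1+a+c : suc a + c ≡ q
  q≡1+a+c = m+[n∸m]≡n a<q
  expand : ∀ a c → a * (suc a + c) + c ≡ (a + c) * suc a
  expand = solve-∀

-- (1 - 1/a)^R ≤ (1 - 1/q)^R ≤ 2^(-M): each of the M blocks of q factors (1 - 1/q) is at most 1/2.
survival : ∀ {a q M R X} → 1 ≤ a → a ≤ q → q * M ≤ R → X ≤ 2 ^ M → X * (a ∸ 1) ^ R ≤ a ^ R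
survival {a} {q} {M} {R} {X} 1≤a a≤q qM≤R X≤2^M = *-cancelˡ-≤ (q ^ R) {{q^R≢0}} (begin
  q ^ R * (X * (a ∸ 1) ^ R)         ≡⟨ x∙yz≈y∙xz (q ^ R) X _ ⟩
  X * (q ^ R * (a ∸ 1) ^ R)         ≡⟨ cong (X *_) (trans (*-comm (q ^ R) _) (sym (^-distrib-* (a ∸ 1) q R))) ⟩
  X * ((a ∸ 1) * q) ^ R             ≤⟨ *-monoʳ-≤ X (^-monoˡ-≤ R ([a∸1]*q≤[q∸1]*a 1≤a a≤q)) ⟩
  X * ((q ∸ 1) * a) ^ R             ≡⟨ cong (X *_) (^-distrib-* (q ∸ 1) a R) ⟩
  X * ((q ∸ 1) ^ R * a ^ R)         ≡⟨ sym (*-assoc X _ (a ^ R)) ⟩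
  X * (q ∸ 1) ^ R * a ^ R           ≤⟨ *-monoˡ-≤ (a ^ R) (≤-trans (≤-reflexive (*-comm X _)) (*-monoʳ-≤ ((q ∸ 1) ^ R) X≤2^M)) ⟩
  (q ∸ 1) ^ R * 2 ^ M * a ^ R       ≤⟨ *-monoˡ-≤ (a ^ R) ([q∸1]^R*2^M≤q^R q (≤-trans 1≤a a≤q) qM≤R) ⟩
  q ^ R * a ^ R                     ∎)
  where
  open ≤-Reasoning
  q^R≢0 : NonZero (q ^ R)
  q^R≢0 = >-nonZero (m^n>0 q {{>-nonZero (≤-trans 1≤a a≤q)}} R)

-- Finite sums

𝟙 : {P : Set} → Dec P → ℕ
𝟙 P? = if does P? then 1 else 0

𝟙-¬?+𝟙 : {P : Set} (P? : Dec P) → 𝟙 (¬? P?) + 𝟙 P? ≡ 1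
𝟙-¬?+𝟙 (yes _) = refl
𝟙-¬?+𝟙 (no _)  = refl

𝟙-¬?≡0 : {P : Set} (P? : Dec P) → 𝟙 (¬? P?) ≡ 0 → P
𝟙-¬?≡0 (yes p) _ = p
𝟙-¬?≡0 (no _)  ()

𝟙-×-dec : {P Q : Set} (P? : Dec P) (Q? : Dec Q) → 𝟙 (P? ×-dec Q?) ≡ 𝟙 P? * 𝟙 Q?
𝟙-×-dec P? Q? with does P? | does Q?
... | true  | true  = refl
... | true  | false = refl
... | false | _     = refl

∑-const : ∀ n c → ∑[ i < n ] c ≡ n * c
∑-const zero    c = refl
∑-const (suc n) c = cong (c +_) (∑-const n c)

∑-mono-≤ : ∀ n {f g : Fin n → ℕ} → (∀ i → f i ≤ g i) → ∑[ i < n ] f i ≤ ∑[ i < n ] g i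
∑-mono-≤ zero    f≤g = z≤n
∑-mono-≤ (suc n) f≤g = +-mono-≤ (f≤g zero) (∑-mono-≤ n (f≤g ∘ suc))

term≤∑ : ∀ n (f : Fin n → ℕ) i → f i ≤ ∑[ j < n ] f j
term≤∑ (suc n) f zero    = m≤m+n _ _
term≤∑ (suc n) f (suc i) = ≤-trans (term≤∑ n (f ∘ suc) i) (m≤n+m _ _)

term≤∑-toℕ : ∀ n (f : ℕ → ℕ) {i} → i < n → f i ≤ ∑[ j < n ] f (toℕ j)
term≤∑-toℕ (suc n) f {zero}  _         = m≤m+n _ _
term≤∑-toℕ (suc n) f {suc i} (s≤s i<n) = ≤-trans (term≤∑-toℕ n (f ∘ suc) i<n) (m≤n+m _ _)

∑Bits : ∀ m → (Vec Bool m → ℕ) → ℕ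
∑Bits zero    f = f []
∑Bits (suc m) f = ∑Bits m (f ∘ (true ∷_)) + ∑Bits m (f ∘ (false ∷_))

∑Bits-cong : ∀ m {f g : Vec Bool m → ℕ} → (∀ v → f v ≡ g v) → ∑Bits m f ≡ ∑Bits m g
∑Bits-cong zero    f≗g = f≗g []
∑Bits-cong (suc m) f≗g = cong₂ _+_ (∑Bits-cong m (f≗g ∘ (true ∷_))) (∑Bits-cong m (f≗g ∘ (false ∷_)))

∑Bits-distrib-+ : ∀ m (f g : Vec Bool m → ℕ) → ∑Bits m (λ v → f v + g v) ≡ ∑Bits m f + ∑Bits m g
∑Bits-distrib-+ zero    f g = refl
∑Bits-distrib-+ (suc m) f g = trans
  (cong₂ _+_ (∑Bits-distrib-+ m _ _) (∑Bits-distrib-+ m _ _))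
  (interchange (∑Bits m (f ∘ (true ∷_))) _ _ _)

*-distribˡ-∑Bits : ∀ m c (f : Vec Bool m → ℕ) → c * ∑Bits m f ≡ ∑Bits m (λ v → c * f v)
*-distribˡ-∑Bits zero    c f = refl
*-distribˡ-∑Bits (suc m) c f = trans (*-distribˡ-+ c _ _) (cong₂ _+_ (*-distribˡ-∑Bits m c _) (*-distribˡ-∑Bits m c _))

*-distribʳ-∑Bits : ∀ m c (f : Vec Bool m → ℕ) → ∑Bits m f * c ≡ ∑Bits m (λ v → f v * c)
*-distribʳ-∑Bits m c f =
  trans (*-comm (∑Bits m f) c) (trans (*-distribˡ-∑Bits m c f) (∑Bits-cong m (λ v → *-comm c (f v))))

∑Bits-const : ∀ m c → ∑Bits m (const c) ≡ 2 ^ m * c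
∑Bits-const zero    c = sym (*-identityˡ c)
∑Bits-const (suc m) c = begin
  ∑Bits m (const c) + ∑Bits m (const c) ≡⟨ cong₂ _+_ (∑Bits-const m c) (∑Bits-const m c) ⟩
  2 ^ m * c + 2 ^ m * c                 ≡⟨ sym (*-distribʳ-+ c (2 ^ m) (2 ^ m)) ⟩
  (2 ^ m + 2 ^ m) * c                   ≡⟨ cong (λ x → (2 ^ m + x) * c) (sym (+-identityʳ (2 ^ m))) ⟩
  2 ^ suc m * c                         ∎
  where open ≡-Reasoning

∑Bits-zero : ∀ m → ∑Bits m (const 0) ≡ 0
∑Bits-zero m = trans (∑Bits-const m 0) (*-zeroʳ (2 ^ m))

∑Bits-mono-≤ : ∀ m {f g : Vec Bool m → ℕ} → (∀ v → f v ≤ g v) → ∑Bits m f ≤ ∑Bits m g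
∑Bits-mono-≤ zero    f≤g = f≤g []
∑Bits-mono-≤ (suc m) f≤g = +-mono-≤ (∑Bits-mono-≤ m (f≤g ∘ (true ∷_))) (∑Bits-mono-≤ m (f≤g ∘ (false ∷_)))

term≤∑Bits : ∀ m (f : Vec Bool m → ℕ) v → f v ≤ ∑Bits m f
term≤∑Bits zero    f []          = ≤-refl
term≤∑Bits (suc m) f (true ∷ v)  = ≤-trans (term≤∑Bits m (f ∘ (true ∷_)) v) (m≤m+n _ _)
term≤∑Bits (suc m) f (false ∷ v) = ≤-trans (term≤∑Bits m (f ∘ (false ∷_)) v) (m≤n+m _ _)

∑Bits<2^m⇒zero : ∀ m (f : Vec Bool m → ℕ) → ∑Bits m f < 2 ^ m → ∃ λ v → f v ≡ 0
∑Bits<2^m⇒zero zero    f ∑f<1 = [] , n<1⇒n≡0 ∑f<1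
∑Bits<2^m⇒zero (suc m) f ∑f<2^m
  with ∑Bits m (f ∘ (true ∷_)) <? 2 ^ m | ∑Bits m (f ∘ (false ∷_)) <? 2 ^ m
... | yes small | _ = let v , fv≡0 = ∑Bits<2^m⇒zero m _ small in true ∷ v , fv≡0
... | no _ | yes small = let v , fv≡0 = ∑Bits<2^m⇒zero m _ small in false ∷ v , fv≡0
... | no big₁ | no big₂ = contradiction ∑f<2^m (≤⇒≯ (begin
  2 ^ suc m                                               ≡⟨ cong (2 ^ m +_) (+-identityʳ (2 ^ m)) ⟩
  2 ^ m + 2 ^ m                                           ≤⟨ +-mono-≤ (≮⇒≥ big₁) (≮⇒≥ big₂) ⟩
  ∑Bits m (f ∘ (true ∷_)) + ∑Bits m (f ∘ (false ∷_))      ∎))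
  where open ≤-Reasoning

∑Bits-comm : ∀ m d (f : Vec Bool m → Vec Bool d → ℕ) →
  ∑Bits m (λ v → ∑Bits d (f v)) ≡ ∑Bits d (λ w → ∑Bits m (λ v → f v w))
∑Bits-comm zero    d f = refl
∑Bits-comm (suc m) d f = trans (cong₂ _+_ (∑Bits-comm m d _) (∑Bits-comm m d _)) (sym (∑Bits-distrib-+ d _ _))

∑Bits-comm-∑ : ∀ m n (f : Vec Bool m → Fin n → ℕ) →
  ∑Bits m (λ v → ∑[ i < n ] f v i) ≡ ∑[ i < n ] ∑Bits m (λ v → f v i)
∑Bits-comm-∑ zero    n f = refl
∑Bits-comm-∑ (suc m) n f = trans (cong₂ _+_ (∑Bits-comm-∑ m n _) (∑Bits-comm-∑ m n _)) (sym (∑-distrib-+ {n} _ _))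

∑Bits-bound : ∀ m {c B} (f : Vec Bool m → ℕ) → (∀ v → c * f v ≤ B) → c * ∑Bits m f ≤ 2 ^ m * B
∑Bits-bound m {c} {B} f cf≤B = begin
  c * ∑Bits m f              ≡⟨ *-distribˡ-∑Bits m c f ⟩
  ∑Bits m (λ v → c * f v)    ≤⟨ ∑Bits-mono-≤ m cf≤B ⟩
  ∑Bits m (const B)          ≡⟨ ∑Bits-const m B ⟩
  2 ^ m * B                  ∎
  where open ≤-Reasoning

∑Tuples : ∀ N s → (Vec (Fin N) s → ℕ) → ℕ
∑Tuples N zero    f = f []
∑Tuples N (suc s) f = ∑[ x < N ] ∑Tuples N s (f ∘ (x ∷_))

∑Tuples-cong : ∀ N s {f g : Vec (Fin N) s → ℕ} → (∀ u → f u ≡ g u) → ∑Tuples N s f ≡ ∑Tuples N s g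
∑Tuples-cong N zero    f≗g = f≗g []
∑Tuples-cong N (suc s) f≗g = sum-cong-≗ (λ x → ∑Tuples-cong N s (f≗g ∘ (x ∷_)))

term≤∑Tuples : ∀ N s (f : Vec (Fin N) s → ℕ) u → f u ≤ ∑Tuples N s f
term≤∑Tuples N zero    f []      = ≤-refl
term≤∑Tuples N (suc s) f (x ∷ u) = ≤-trans (term≤∑Tuples N s (f ∘ (x ∷_)) u) (term≤∑ N _ x)

∑Tuples-bound : ∀ N s {c B} (f : Vec (Fin N) s → ℕ) → (∀ u → c * f u ≤ B) → c * ∑Tuples N s f ≤ N ^ s * B
∑Tuples-bound N zero    {c} {B} f cf≤B = ≤-trans (cf≤B []) (≤-reflexive (sym (*-identityˡ B)))
∑Tuples-bound N (suc s) {c} {B} f cf≤B = begin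
  c * ∑[ x < N ] ∑Tuples N s (f ∘ (x ∷_))   ≡⟨ *-distribˡ-sum {N} c _ ⟩
  ∑[ x < N ] (c * ∑Tuples N s (f ∘ (x ∷_))) ≤⟨ ∑-mono-≤ N (λ x → ∑Tuples-bound N s {c} {B} (f ∘ (x ∷_)) (cf≤B ∘ (x ∷_))) ⟩
  ∑[ x < N ] (N ^ s * B)                    ≡⟨ ∑-const N _ ⟩
  N * (N ^ s * B)                           ≡⟨ sym (*-assoc N _ B) ⟩
  N ^ suc s * B                             ∎
  where open ≤-Reasoning

∑Bits-comm-∑Tuples : ∀ m N s (f : Vec Bool m → Vec (Fin N) s → ℕ) →
  ∑Bits m (λ v → ∑Tuples N s (f v)) ≡ ∑Tuples N s (λ u → ∑Bits m (λ v → f v u))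
∑Bits-comm-∑Tuples m N zero    f = refl
∑Bits-comm-∑Tuples m N (suc s) f =
  trans (∑Bits-comm-∑ m N _) (sum-cong-≗ (λ x → ∑Bits-comm-∑Tuples m N s (λ v → f v ∘ (x ∷_))))

-- Independent bits

select : ∀ {m d} → Vec (Fin m) d → Vec Bool m → Vec Bool d
select P v = map (lookup v) P

_≟ᵥ_ : ∀ {d} → DecidableEquality (Vec Bool d)
_≟ᵥ_ = ≡-dec Bool._≟_

Ignores : ∀ {m} → Fin m → (Vec Bool m → ℕ) → Set
Ignores p g = ∀ v b → g (v [ p ]≔ b) ≡ g v

select-update : ∀ {m d} {p : Fin m} (P : Vec (Fin m) d) → All (p ≢_) P →
  ∀ v b → select P (v [ p ]≔ b) ≡ select P v
select-update []      []            v b = refl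
select-update (q ∷ P) (p≢q ∷ p∉P) v b = cong₂ _∷_ (lookup∘update′ (≢-sym p≢q) v b) (select-update P p∉P v b)

∑Bits-pick : ∀ d (h : Vec Bool d → ℕ) t → ∑Bits d (λ w → h w * 𝟙 (t ≟ᵥ w)) ≡ h t
∑Bits-pick zero    h []        = *-identityʳ (h [])
∑Bits-pick (suc d) h (true ∷ t) = begin
  ∑Bits d (λ w → h (true ∷ w) * 𝟙 (t ≟ᵥ w)) + ∑Bits d (λ w → h (false ∷ w) * 0)
    ≡⟨ cong₂ _+_ (∑Bits-pick d (h ∘ (true ∷_)) t) (trans (∑Bits-cong d (λ w → *-zeroʳ (h (false ∷ w)))) (∑Bits-zero d)) ⟩
  h (true ∷ t) + 0
    ≡⟨ +-identityʳ _ ⟩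
  h (true ∷ t) ∎
  where open ≡-Reasoning
∑Bits-pick (suc d) h (false ∷ t) = begin
  ∑Bits d (λ w → h (true ∷ w) * 0) + ∑Bits d (λ w → h (false ∷ w) * 𝟙 (t ≟ᵥ w))
    ≡⟨ cong₂ _+_ (trans (∑Bits-cong d (λ w → *-zeroʳ (h (true ∷ w)))) (∑Bits-zero d)) (∑Bits-pick d (h ∘ (false ∷_)) t) ⟩
  h (false ∷ t) ∎
  where open ≡-Reasoning

∑Bits-fix-bit : ∀ m (p : Fin m) b (g : Vec Bool m → ℕ) → Ignores p g →
  2 * ∑Bits m (λ v → 𝟙 (lookup v p Bool.≟ b) * g v) ≡ ∑Bits m g
∑Bits-fix-bit (suc m) zero true g ignores = begin
  2 * (∑Bits m (λ v → 1 * g (true ∷ v)) + ∑Bits m (const 0))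
    ≡⟨ cong₂ (λ x y → 2 * (x + y)) (∑Bits-cong m (λ v → *-identityˡ _)) (∑Bits-zero m) ⟩
  2 * (A + 0)  ≡⟨ cong (2 *_) (+-identityʳ A) ⟩
  2 * A        ≡⟨ cong (A +_) (+-identityʳ A) ⟩
  A + A        ≡⟨ cong (A +_) (∑Bits-cong m (λ v → sym (ignores (true ∷ v) false))) ⟩
  A + B        ∎
  where
  open ≡-Reasoning
  A = ∑Bits m (g ∘ (true ∷_))
  B = ∑Bits m (g ∘ (false ∷_))
∑Bits-fix-bit (suc m) zero false g ignores = begin
  2 * (∑Bits m (const 0) + ∑Bits m (λ v → 1 * g (false ∷ v)))
    ≡⟨ cong₂ (λ x y → 2 * (x + y)) (∑Bits-zero m) (∑Bits-cong m (λ v → *-identityˡ _)) ⟩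
  2 * B        ≡⟨ cong (B +_) (+-identityʳ B) ⟩
  B + B        ≡⟨ cong (_+ B) (∑Bits-cong m (λ v → sym (ignores (false ∷ v) true))) ⟩
  A + B        ∎
  where
  open ≡-Reasoning
  A = ∑Bits m (g ∘ (true ∷_))
  B = ∑Bits m (g ∘ (false ∷_))
∑Bits-fix-bit (suc m) (suc p) b g ignores = trans
  (*-distribˡ-+ 2 (∑Bits m (λ v → 𝟙 (lookup v p Bool.≟ b) * g (true ∷ v)))
                  (∑Bits m (λ v → 𝟙 (lookup v p Bool.≟ b) * g (false ∷ v))))
  (cong₂ _+_
  (∑Bits-fix-bit m p b (g ∘ (true ∷_)) (λ v → ignores (true ∷ v)))
  (∑Bits-fix-bit m p b (g ∘ (false ∷_)) (λ v → ignores (false ∷ v))))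

∑Bits-fix-pattern : ∀ m {d} (P : Vec (Fin m) d) w (g : Vec Bool m → ℕ) →
  Unique P → All (λ p → Ignores p g) P →
  2 ^ d * ∑Bits m (λ v → 𝟙 (select P v ≟ᵥ w) * g v) ≡ ∑Bits m g
∑Bits-fix-pattern m [] [] g [] [] = trans (*-identityˡ _) (∑Bits-cong m (λ v → *-identityˡ (g v)))
∑Bits-fix-pattern m {suc d} (p ∷ P) (b ∷ w) g (p∉P ∷ P!) (ignores-p ∷ ignores-P) = begin
  2 ^ suc d * ∑Bits m (λ v → 𝟙 (select (p ∷ P) v ≟ᵥ (b ∷ w)) * g v)
    ≡⟨ cong (2 ^ suc d *_) (∑Bits-cong m (λ v → trans (cong (_* g v) (𝟙-×-dec (lookup v p Bool.≟ b) (select P v ≟ᵥ w)))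
                                                   (*-assoc (𝟙 (lookup v p Bool.≟ b)) _ (g v)))) ⟩
  2 ^ suc d * ∑Bits m (λ v → 𝟙 (lookup v p Bool.≟ b) * g′ v)
    ≡⟨ trans (cong (_* fixed) (*-comm 2 (2 ^ d))) (*-assoc (2 ^ d) 2 fixed) ⟩
  2 ^ d * (2 * ∑Bits m (λ v → 𝟙 (lookup v p Bool.≟ b) * g′ v))
    ≡⟨ cong (2 ^ d *_) (∑Bits-fix-bit m p b g′ ignores-p′) ⟩
  2 ^ d * ∑Bits m g′
    ≡⟨ ∑Bits-fix-pattern m P w g P! ignores-P ⟩
  ∑Bits m g ∎
  where
  open ≡-Reasoning
  g′ : Vec Bool m → ℕ
  g′ v = 𝟙 (select P v ≟ᵥ w) * g v
  fixed : ℕ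
  fixed = ∑Bits m (λ v → 𝟙 (lookup v p Bool.≟ b) * g′ v)
  ignores-p′ : Ignores p g′
  ignores-p′ v c = cong₂ (λ t x → 𝟙 (t ≟ᵥ w) * x) (select-update P p∉P v c) (ignores-p v c)

∑Bits-pattern : ∀ m {d} (P : Vec (Fin m) d) t → Unique P → 2 ^ d * ∑Bits m (λ v → 𝟙 (select P v ≟ᵥ t)) ≡ 2 ^ m
∑Bits-pattern m {d} P t P! = begin
  2 ^ d * ∑Bits m (λ v → 𝟙 (select P v ≟ᵥ t))      ≡⟨ cong (2 ^ d *_) (∑Bits-cong m (λ v → sym (*-identityʳ _))) ⟩
  2 ^ d * ∑Bits m (λ v → 𝟙 (select P v ≟ᵥ t) * 1)  ≡⟨ ∑Bits-fix-pattern m P t (const 1) P! (All.universal (λ _ _ _ → refl) P) ⟩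
  ∑Bits m (const 1)                                 ≡⟨ trans (∑Bits-const m 1) (*-identityʳ _) ⟩
  2 ^ m                                             ∎
  where open ≡-Reasoning

∑Bits-select : ∀ m {d} (P : Vec (Fin m) d) (h : Vec Bool d → ℕ) (g : Vec Bool m → ℕ) →
  Unique P → All (λ p → Ignores p g) P →
  2 ^ d * ∑Bits m (λ v → h (select P v) * g v) ≡ ∑Bits d h * ∑Bits m g
∑Bits-select m {d} P h g P! ignores = begin
  2 ^ d * ∑Bits m (λ v → h (select P v) * g v)
    ≡⟨ cong (2 ^ d *_) (∑Bits-cong m (λ v → trans (cong (_* g v) (sym (∑Bits-pick d h (select P v))))
                                                  (*-distribʳ-∑Bits d (g v) _))) ⟩
  2 ^ d * ∑Bits m (λ v → ∑Bits d (λ w → h w * 𝟙 (select P v ≟ᵥ w) * g v))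
    ≡⟨ cong (2 ^ d *_) (∑Bits-comm m d _) ⟩
  2 ^ d * ∑Bits d (λ w → ∑Bits m (λ v → h w * 𝟙 (select P v ≟ᵥ w) * g v))
    ≡⟨ *-distribˡ-∑Bits d (2 ^ d) _ ⟩
  ∑Bits d (λ w → 2 ^ d * ∑Bits m (λ v → h w * 𝟙 (select P v ≟ᵥ w) * g v))
    ≡⟨ ∑Bits-cong d fix-w ⟩
  ∑Bits d (λ w → h w * ∑Bits m g)
    ≡⟨ sym (*-distribʳ-∑Bits d (∑Bits m g) h) ⟩
  ∑Bits d h * ∑Bits m g ∎
  where
  open ≡-Reasoning
  fix-w : ∀ w → 2 ^ d * ∑Bits m (λ v → h w * 𝟙 (select P v ≟ᵥ w) * g v) ≡ h w * ∑Bits m g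
  fix-w w = begin
    2 ^ d * ∑Bits m (λ v → h w * 𝟙 (select P v ≟ᵥ w) * g v)
      ≡⟨ cong (2 ^ d *_) (trans (∑Bits-cong m (λ v → *-assoc (h w) _ (g v))) (sym (*-distribˡ-∑Bits m (h w) _))) ⟩
    2 ^ d * (h w * ∑Bits m (λ v → 𝟙 (select P v ≟ᵥ w) * g v))
      ≡⟨ x∙yz≈y∙xz (2 ^ d) (h w) _ ⟩
    h w * (2 ^ d * ∑Bits m (λ v → 𝟙 (select P v ≟ᵥ w) * g v))
      ≡⟨ cong (h w *_) (∑Bits-fix-pattern m P w g P! ignores) ⟩
    h w * ∑Bits m g ∎

∑Bits-mismatch : ∀ d (t : Vec Bool d) → ∑Bits d (λ w → 𝟙 (¬? (t ≟ᵥ w))) ≡ 2 ^ d ∸ 1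
∑Bits-mismatch d t = begin
  ∑Bits d (λ w → 𝟙 (¬? (t ≟ᵥ w)))                                  ≡⟨ sym (m+n∸n≡m _ 1) ⟩
  ∑Bits d (λ w → 𝟙 (¬? (t ≟ᵥ w))) + 1 ∸ 1                          ≡⟨ cong (λ x → mismatches + x ∸ 1) (sym one-match) ⟩
  ∑Bits d (λ w → 𝟙 (¬? (t ≟ᵥ w))) + ∑Bits d (λ w → 𝟙 (t ≟ᵥ w)) ∸ 1 ≡⟨ cong (_∸ 1) (sym (∑Bits-distrib-+ d _ _)) ⟩
  ∑Bits d (λ w → 𝟙 (¬? (t ≟ᵥ w)) + 𝟙 (t ≟ᵥ w)) ∸ 1                ≡⟨ cong (_∸ 1) (∑Bits-cong d (λ w → 𝟙-¬?+𝟙 (t ≟ᵥ w))) ⟩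
  ∑Bits d (const 1) ∸ 1                                            ≡⟨ cong (_∸ 1) (trans (∑Bits-const d 1) (*-identityʳ (2 ^ d))) ⟩
  2 ^ d ∸ 1                                                        ∎
  where
  open ≡-Reasoning
  mismatches : ℕ
  mismatches = ∑Bits d (λ w → 𝟙 (¬? (t ≟ᵥ w)))
  one-match : ∑Bits d (λ w → 𝟙 (t ≟ᵥ w)) ≡ 1
  one-match = trans (sym (∑Bits-cong d (λ w → *-identityˡ _))) (∑Bits-pick d (const 1) t)

-- Graphs coded by bit vectors

pairIndex : ∀ {N} → Fin N → Fin N → Fin (N * N)
pairIndex i j with i Fin.≤? j
... | yes _ = combine i j
... | no  _ = combine j i

pairIndex-comm : ∀ {N} (i j : Fin N) → pairIndex i j ≡ pairIndex j i
pairIndex-comm i j with i Fin.≤? j | j Fin.≤? i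
... | yes i≤j | yes j≤i = cong₂ combine (Fin.≤-antisym i≤j j≤i) (Fin.≤-antisym j≤i i≤j)
... | yes _   | no  _   = refl
... | no  _   | yes _   = refl
... | no  i≰j | no  j≰i = contradiction (<⇒≤ (≰⇒> i≰j)) j≰i

pairIndex-injective : ∀ {N} (a b c d : Fin N) → pairIndex a b ≡ pairIndex c d →
  (a ≡ c × b ≡ d) ⊎ (a ≡ d × b ≡ c)
pairIndex-injective a b c d eq with a Fin.≤? b | c Fin.≤? d
... | yes _ | yes _ = inj₁ (combine-injective a b c d eq)
... | yes _ | no  _ = inj₂ (combine-injective a b d c eq)
... | no  _ | yes _ = let b≡c , a≡d = combine-injective b a c d eq in inj₂ (a≡d , b≡c)
... | no  _ | no  _ = let b≡d , a≡c = combine-injective b a d c eq in inj₁ (a≡c , b≡d)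

pairIndex-injectiveʳ : ∀ {N} {x a b : Fin N} → pairIndex x a ≡ pairIndex x b → a ≡ b
pairIndex-injectiveʳ {x = x} {a} {b} eq with pairIndex-injective x a x b eq
... | inj₁ (_ , a≡b)   = a≡b
... | inj₂ (x≡b , a≡x) = trans a≡x x≡b

pairIndex-≢ : ∀ {N} {x y a b : Fin N} → x ≢ y → x ≢ b → pairIndex x a ≢ pairIndex y b
pairIndex-≢ {x = x} {y} {a} {b} x≢y x≢b eq with pairIndex-injective x a y b eq
... | inj₁ (x≡y , _) = x≢y x≡y
... | inj₂ (x≡b , _) = x≢b x≡b

adjacency : ∀ {N} → Vec Bool (N * N) → Fin N → Fin N → Bool
adjacency v i j = if does (i Fin.≟ j) then false else lookup v (pairIndex i j)

adjacency-≢ : ∀ {N} (v : Vec Bool (N * N)) {i j : Fin N} → i ≢ j → adjacency v i j ≡ lookup v (pairIndex i j)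
adjacency-≢ v {i} {j} i≢j with i Fin.≟ j
... | yes i≡j = contradiction i≡j i≢j
... | no  _   = refl

adjacency-sym : ∀ {N} (v : Vec Bool (N * N)) (i j : Fin N) → adjacency v i j ≡ adjacency v j i
adjacency-sym v i j with i Fin.≟ j | j Fin.≟ i
... | yes _   | yes _   = refl
... | yes i≡j | no  j≢i = contradiction (sym i≡j) j≢i
... | no  i≢j | yes j≡i = contradiction (sym j≡i) i≢j
... | no  _   | no  _   = cong (lookup v) (pairIndex-comm i j)

adjacency-irrefl : ∀ {N} (v : Vec Bool (N * N)) (i : Fin N) → adjacency v i i ≡ false
adjacency-irrefl v i with i Fin.≟ i
... | yes _   = refl
... | no  i≢i = contradiction refl i≢i

graphOf : ∀ N → Vec Bool (N * N) → Graph
graphOf N v = record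
  { n = N ; adj = adjacency {N} v ; sym = adjacency-sym {N} v ; loopless = adjacency-irrefl {N} v }

-- Induced copies

choose2 : ℕ → ℕ
choose2 zero    = 0
choose2 (suc ℓ) = ℓ + choose2 ℓ

pairIndices : ∀ {N ℓ} → Vec (Fin N) ℓ → Vec (Fin (N * N)) (choose2 ℓ)
pairIndices []      = []
pairIndices (x ∷ φ) = map (pairIndex x) φ ++ pairIndices φ

adjacencyPattern : ∀ ℓ → (Fin ℓ → Fin ℓ → Bool) → Vec Bool (choose2 ℓ)
adjacencyPattern zero    A = []
adjacencyPattern (suc ℓ) A = tabulate (A zero ∘ suc) ++ adjacencyPattern ℓ (λ i j → A (suc i) (suc j))

pairIndex∉pairIndices : ∀ {N ℓ} {x : Fin N} a (φ : Vec (Fin N) ℓ) → All (x ≢_) φ →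
  All (pairIndex x a ≢_) (pairIndices φ)
pairIndex∉pairIndices a []      []            = []
pairIndex∉pairIndices a (y ∷ φ) (x≢y ∷ x∉φ) =
  All.++⁺ (All.gmap (pairIndex-≢ x≢y) x∉φ) (pairIndex∉pairIndices a φ x∉φ)

pairIndices-unique : ∀ {N ℓ} {φ : Vec (Fin N) ℓ} → Unique φ → Unique (pairIndices φ)
pairIndices-unique {φ = []}    []            = []
pairIndices-unique {φ = x ∷ φ} (x∉φ ∷ φ!) = AllPairs.++⁺
  (Unique.map⁺ (pairIndex-injectiveʳ {x = x}) φ!)
  (pairIndices-unique φ!)
  (All.map⁺ (All.universal (λ a → pairIndex∉pairIndices a φ x∉φ) φ))

select-pairIndices : ∀ {N ℓ} (v : Vec Bool (N * N)) (f : Fin ℓ → Fin N) (A : Fin ℓ → Fin ℓ → Bool) →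
  (∀ {i j} → f i ≡ f j → i ≡ j) → (∀ i j → adjacency v (f i) (f j) ≡ A i j) →
  select (pairIndices (tabulate f)) v ≡ adjacencyPattern ℓ A
select-pairIndices {ℓ = zero}  v f A f-inj f-induced = refl
select-pairIndices {ℓ = suc ℓ} v f A f-inj f-induced = begin
  select (map (pairIndex (f zero)) (tabulate (f ∘ suc)) ++ pairIndices (tabulate (f ∘ suc))) v
    ≡⟨ map-++ (lookup v) (map (pairIndex (f zero)) (tabulate (f ∘ suc))) _ ⟩
  select (map (pairIndex (f zero)) (tabulate (f ∘ suc))) v ++ select (pairIndices (tabulate (f ∘ suc))) v
    ≡⟨ cong₂ _++_ first-row
         (select-pairIndices v (f ∘ suc) (λ i j → A (suc i) (suc j)) (Fin.suc-injective ∘ f-inj) (λ i j → f-induced (suc i) (suc j))) ⟩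
  tabulate (A zero ∘ suc) ++ adjacencyPattern ℓ (λ i j → A (suc i) (suc j)) ∎
  where
  open ≡-Reasoning
  first-row : select (map (pairIndex (f zero)) (tabulate (f ∘ suc))) v ≡ tabulate (A zero ∘ suc)
  first-row = begin
    map (lookup v) (map (pairIndex (f zero)) (tabulate (f ∘ suc)))
      ≡⟨ sym (map-∘ (lookup v) (pairIndex (f zero)) _) ⟩
    map (lookup v ∘ pairIndex (f zero)) (tabulate (f ∘ suc))
      ≡⟨ sym (tabulate-∘ _ (f ∘ suc)) ⟩
    tabulate (λ j → lookup v (pairIndex (f zero) (f (suc j))))
      ≡⟨ tabulate-cong (λ j → trans (sym (adjacency-≢ v (Fin.0≢1+n ∘ f-inj))) (f-induced zero (suc j))) ⟩
    tabulate (A zero ∘ suc) ∎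

unique? : ∀ {N s} (u : Vec (Fin N) s) → Dec (Unique u)
unique? = allPairs? (λ x y → ¬? (x Fin.≟ y))

inducedCopies : ∀ N ℓ → (Fin ℓ → Fin ℓ → Bool) → Vec Bool (N * N) → ℕ
inducedCopies N ℓ A v = ∑Tuples N ℓ (λ φ → 𝟙 (unique? φ) * 𝟙 (select (pairIndices φ) v ≟ᵥ adjacencyPattern ℓ A))

∑Bits-inducedCopies : ∀ N ℓ A → 2 ^ choose2 ℓ * ∑Bits (N * N) (inducedCopies N ℓ A) ≤ N ^ ℓ * 2 ^ (N * N)
∑Bits-inducedCopies N ℓ A = begin
  2 ^ choose2 ℓ * ∑Bits m (inducedCopies N ℓ A)    ≡⟨ cong (2 ^ choose2 ℓ *_) (∑Bits-comm-∑Tuples m N ℓ _) ⟩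
  2 ^ choose2 ℓ * ∑Tuples N ℓ copiesAt             ≤⟨ ∑Tuples-bound N ℓ {2 ^ choose2 ℓ} copiesAt copiesAt-bound ⟩
  N ^ ℓ * 2 ^ m                                    ∎
  where
  open ≤-Reasoning
  m = N * N
  copiesAt : Vec (Fin N) ℓ → ℕ
  copiesAt φ = ∑Bits m (λ v → 𝟙 (unique? φ) * 𝟙 (select (pairIndices φ) v ≟ᵥ adjacencyPattern ℓ A))
  copiesAt-bound : ∀ φ → 2 ^ choose2 ℓ * copiesAt φ ≤ 2 ^ m
  copiesAt-bound φ with unique? φ
  ... | yes φ! = ≤-reflexive (trans (cong (2 ^ choose2 ℓ *_) (∑Bits-cong m (λ v → *-identityˡ _)))
                                    (∑Bits-pattern m (pairIndices φ) _ (pairIndices-unique φ!)))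
  ... | no  _  = ≤-trans (≤-reflexive (trans (cong (2 ^ choose2 ℓ *_) (∑Bits-zero m)) (*-zeroʳ (2 ^ choose2 ℓ)))) z≤n

inducedCopies≡0⇒⋢ : ∀ N (F : Graph) v → inducedCopies N (n F) (adj F) v ≡ 0 → ¬ F ⊏ graphOf N v
inducedCopies≡0⇒⋢ N F v no-copies (f , f-inj , f-induced) = contradiction (≤-trans one≤copy copy≤0) (λ ())
  where
  φ = tabulate f
  φ! : Unique φ
  φ! = Unique.tabulate⁺ f-inj
  one≤copy : 1 ≤ 𝟙 (unique? φ) * 𝟙 (select (pairIndices φ) v ≟ᵥ adjacencyPattern (n F) (adj F))
  one≤copy rewrite dec-true (unique? φ) φ!
                 | dec-true (select (pairIndices φ) v ≟ᵥ _) (select-pairIndices v f (adj F) f-inj f-induced) = s≤s z≤n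
  copy≤0 : 𝟙 (unique? φ) * 𝟙 (select (pairIndices φ) v ≟ᵥ adjacencyPattern (n F) (adj F)) ≤ 0
  copy≤0 = ≤-trans (term≤∑Tuples N (n F) _ φ) (≤-reflexive no-copies)

2*choose2+n≡n*n : ∀ n → 2 * choose2 n + n ≡ n * n
2*choose2+n≡n*n zero    = refl
2*choose2+n≡n*n (suc n) = begin
  2 * (n + choose2 n) + suc n   ≡⟨ rearrange n (choose2 n) ⟩
  suc (n + n) + (2 * choose2 n + n) ≡⟨ cong (suc (n + n) +_) (2*choose2+n≡n*n n) ⟩
  suc (n + n) + n * n           ≡⟨ square n ⟩
  suc n * suc n                 ∎
  where
  open ≡-Reasoning
  rearrange : ∀ n c → 2 * (n + c) + suc n ≡ suc (n + n) + (2 * c + n)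
  rearrange = solve-∀
  square : ∀ n → suc (n + n) + n * n ≡ suc n * suc n
  square = solve-∀

2*N^ℓ≤2^choose2ℓ : ∀ N L → N * N ≤ 2 ^ L → 2 * N ^ (2 + L) ≤ 2 ^ choose2 (2 + L)
2*N^ℓ≤2^choose2ℓ N L N²≤2^L = square-cancel-≤ (begin
  (2 * N ^ ℓ) * (2 * N ^ ℓ)          ≡⟨ *-interchange 2 (N ^ ℓ) 2 (N ^ ℓ) ⟩
  4 * (N ^ ℓ * N ^ ℓ)                ≡⟨ cong (4 *_) (sym (^-distrib-* N N ℓ)) ⟩
  2 ^ 2 * (N * N) ^ ℓ                ≤⟨ *-monoʳ-≤ 4 (^-monoˡ-≤ ℓ N²≤2^L) ⟩
  2 ^ 2 * (2 ^ L) ^ ℓ                ≡⟨ cong (4 *_) (^-*-assoc 2 L ℓ) ⟩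
  2 ^ 2 * 2 ^ (L * ℓ)                ≡⟨ sym (^-distribˡ-+-* 2 2 (L * ℓ)) ⟩
  2 ^ (2 + L * ℓ)                    ≤⟨ ^-monoʳ-≤ 2 exponent ⟩
  2 ^ (choose2 ℓ + choose2 ℓ)        ≡⟨ ^-distribˡ-+-* 2 (choose2 ℓ) (choose2 ℓ) ⟩
  2 ^ choose2 ℓ * 2 ^ choose2 ℓ      ∎)
  where
  open ≤-Reasoning
  ℓ = 2 + L
  exponent : 2 + L * ℓ ≤ choose2 ℓ + choose2 ℓ
  exponent = +-cancelʳ-≤ ℓ _ _ (begin
    2 + L * ℓ + ℓ                    ≤⟨ m≤m+n _ L ⟩
    2 + L * ℓ + ℓ + L                ≡⟨ expand L ⟩
    ℓ * ℓ                            ≡⟨ sym (2*choose2+n≡n*n ℓ) ⟩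
    2 * choose2 ℓ + ℓ                ≡⟨ cong (_+ ℓ) (cong (choose2 ℓ +_) (+-identityʳ (choose2 ℓ))) ⟩
    choose2 ℓ + choose2 ℓ + ℓ        ∎)
    where
    expand : ∀ L → 2 + L * (2 + L) + (2 + L) + L ≡ (2 + L) * (2 + L)
    expand = solve-∀

-- Failures of the extension axiom

noExtension : ∀ {N s r} → Vec (Fin N) s → Vec Bool s → Vec (Fin N) r → Vec Bool (N * N) → ℕ
noExtension u σ []       v = 1
noExtension u σ (z ∷ zs) v = 𝟙 (¬? (σ ≟ᵥ select (map (pairIndex z) u) v)) * noExtension u σ zs v

noExtension-ignores : ∀ {N s r} (u : Vec (Fin N) s) σ (zs : Vec (Fin N) r) {z} a →
  All (z ≢_) zs → All (z ≢_) u → Ignores (pairIndex z a) (noExtension u σ zs)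
noExtension-ignores u σ []        a []              z∉u v b = refl
noExtension-ignores u σ (z′ ∷ zs) a (z≢z′ ∷ z∉zs) z∉u v b = cong₂ (λ t rest → 𝟙 (¬? (σ ≟ᵥ t)) * rest)
  (select-update (map (pairIndex z′) u) (All.gmap (pairIndex-≢ z≢z′) z∉u) v b)
  (noExtension-ignores u σ zs a z∉zs z∉u v b)

∑Bits-noExtension : ∀ {N s r} (u : Vec (Fin N) s) σ (zs : Vec (Fin N) r) →
  Unique u → Unique zs → All (λ z → All (z ≢_) u) zs →
  2 ^ (s * r) * ∑Bits (N * N) (noExtension u σ zs) ≡ (2 ^ s ∸ 1) ^ r * 2 ^ (N * N)
∑Bits-noExtension {N} {s} u σ [] _ _ _ = begin
  2 ^ (s * 0) * ∑Bits (N * N) (const 1) ≡⟨ cong₂ (λ e x → 2 ^ e * x) (*-zeroʳ s) (∑Bits-const (N * N) 1) ⟩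
  1 * (2 ^ (N * N) * 1)                 ≡⟨ cong (1 *_) (*-identityʳ _) ⟩
  1 * 2 ^ (N * N)                       ∎
  where open ≡-Reasoning
∑Bits-noExtension {N} {s} {suc r} u σ (z ∷ zs) u! (z∉zs ∷ zs!) (z∉u ∷ zs∉u) = begin
  2 ^ (s * suc r) * ∑Bits m (λ v → mismatch (select P v) * rest v)
    ≡⟨ cong (_* ∑Bits m (noExtension u σ (z ∷ zs))) (trans (cong (2 ^_) (*-suc s r)) (^-distribˡ-+-* 2 s (s * r))) ⟩
  (2 ^ s * 2 ^ (s * r)) * ∑Bits m (λ v → mismatch (select P v) * rest v)
    ≡⟨ xy∙z≈y∙xz (2 ^ s) (2 ^ (s * r)) _ ⟩
  2 ^ (s * r) * (2 ^ s * ∑Bits m (λ v → mismatch (select P v) * rest v))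
    ≡⟨ cong (2 ^ (s * r) *_) (∑Bits-select m P mismatch rest P! ignores) ⟩
  2 ^ (s * r) * (∑Bits s mismatch * ∑Bits m rest)
    ≡⟨ cong (λ c → 2 ^ (s * r) * (c * ∑Bits m rest)) (∑Bits-mismatch s σ) ⟩
  2 ^ (s * r) * ((2 ^ s ∸ 1) * ∑Bits m rest)
    ≡⟨ x∙yz≈y∙xz (2 ^ (s * r)) (2 ^ s ∸ 1) _ ⟩
  (2 ^ s ∸ 1) * (2 ^ (s * r) * ∑Bits m rest)
    ≡⟨ cong ((2 ^ s ∸ 1) *_) (∑Bits-noExtension u σ zs u! zs! zs∉u) ⟩
  (2 ^ s ∸ 1) * ((2 ^ s ∸ 1) ^ r * 2 ^ m)
    ≡⟨ sym (*-assoc (2 ^ s ∸ 1) _ _) ⟩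
  (2 ^ s ∸ 1) ^ suc r * 2 ^ m ∎
  where
  open ≡-Reasoning
  m = N * N
  P = map (pairIndex z) u
  mismatch : Vec Bool s → ℕ
  mismatch w = 𝟙 (¬? (σ ≟ᵥ w))
  rest = noExtension u σ zs
  P! : Unique P
  P! = Unique.map⁺ (pairIndex-injectiveʳ {x = z}) u!
  ignores : All (λ p → Ignores p rest) P
  ignores = All.map⁺ (All.universal (λ a → noExtension-ignores u σ zs a z∉zs z∉u) u)

noExtension≡0 : ∀ {N s r} (u : Vec (Fin N) s) σ (zs : Vec (Fin N) r) v → noExtension u σ zs v ≡ 0 →
  Any (λ z → σ ≡ select (map (pairIndex z) u) v) zs
noExtension≡0 u σ (z ∷ zs) v eq with m*n≡0⇒m≡0∨n≡0 (𝟙 (¬? (σ ≟ᵥ select (map (pairIndex z) u) v))) eq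
... | inj₁ mismatch≡0 = Any.here (𝟙-¬?≡0 (σ ≟ᵥ _) mismatch≡0)
... | inj₂ rest≡0     = Any.there (noExtension≡0 u σ zs v rest≡0)

support : ∀ {N s} → Vec (Fin N) s → Subset N
support []      = ⊥
support (x ∷ u) = support u [ x ]≔ inside

∣p[x]≔inside∣≤ : ∀ {n} (p : Subset n) x → ∣ p [ x ]≔ inside ∣ ≤ suc ∣ p ∣
∣p[x]≔inside∣≤ (b       ∷ p) zero    = s≤s (∣p∣≤∣x∷p∣ b p)
∣p[x]≔inside∣≤ (outside ∷ p) (suc x) = ∣p[x]≔inside∣≤ p x
∣p[x]≔inside∣≤ (inside  ∷ p) (suc x) = s≤s (∣p[x]≔inside∣≤ p x)

∣support∣≤ : ∀ {N s} (u : Vec (Fin N) s) → ∣ support u ∣ ≤ s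
∣support∣≤ {N} []  = ≤-reflexive (∣⊥∣≡0 N)
∣support∣≤ (x ∷ u) = ≤-trans (∣p[x]≔inside∣≤ (support u) x) (s≤s (∣support∣≤ u))

∉support : ∀ {N s} {x : Fin N} (u : Vec (Fin N) s) → x ∉ support u → All (x ≢_) u
∉support []      x∉ = []
∉support {x = x} (y ∷ u) x∉ = x≢y ∷ ∉support u (x∉ ∘ []≔-minimal (support u) x y x≢y)
  where
  x≢y : x ≢ y
  x≢y refl = x∉ ([]≔-updates (support u) x)

members : ∀ {n} (p : Subset n) → Vec (Fin n) ∣ p ∣
members []            = []
members (inside  ∷ p) = zero ∷ map suc (members p)
members (outside ∷ p) = map suc (members p)

members-unique : ∀ {n} (p : Subset n) → Unique (members p)
members-unique []            = []
members-unique (inside  ∷ p) = All.map⁺ (All.universal (λ _ ()) (members p)) ∷ Unique.map⁺ Fin.suc-injective (members-unique p)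
members-unique (outside ∷ p) = Unique.map⁺ Fin.suc-injective (members-unique p)

members-all : ∀ {n} {P : Fin n → Set} (p : Subset n) → (∀ {x} → x ∈ p → P x) → All P (members p)
members-all []            _  = []
members-all (inside  ∷ p) Pp = Pp here ∷ All.map⁺ (members-all p (Pp ∘ there))
members-all (outside ∷ p) Pp = All.map⁺ (members-all p (Pp ∘ there))

∈-members : ∀ {n} {x : Fin n} (p : Subset n) → x ∈ p → x ∈ᵥ members p
∈-members (inside  ∷ p) here        = Any.here refl
∈-members (inside  ∷ p) (there x∈p) = Any.there (∈-map⁺ suc (∈-members p x∈p))
∈-members (outside ∷ p) (there x∈p) = ∈-map⁺ suc (∈-members p x∈p)

outsideOf : ∀ {N s} (u : Vec (Fin N) s) → Vec (Fin N) ∣ ∁ (support u) ∣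
outsideOf u = members (∁ (support u))

outsideOf-disjoint : ∀ {N s} (u : Vec (Fin N) s) → All (λ z → All (z ≢_) u) (outsideOf u)
outsideOf-disjoint u = members-all (∁ (support u)) (∉support u ∘ x∈∁p⇒x∉p)

N∸s≤∣outsideOf∣ : ∀ {N s} (u : Vec (Fin N) s) → N ∸ s ≤ ∣ ∁ (support u) ∣
N∸s≤∣outsideOf∣ {N} u = ≤-trans (∸-monoʳ-≤ N (∣support∣≤ u)) (≤-reflexive (sym (∣∁p∣≡n∸∣p∣ (support u))))

-- An instance (X, Y) of EA_k is coded by an injective tuple u listing X ∪ Y and the pattern σ
-- recording which entries of u lie in X; summing over all such (u, σ) overcounts each instance.
extensionFailure : ∀ {N s} → Vec (Fin N) s → Vec Bool s → Vec Bool (N * N) → ℕ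
extensionFailure u σ v = 𝟙 (unique? u) * noExtension u σ (outsideOf u) v

failuresOfSize : ∀ N s → Vec Bool (N * N) → ℕ
failuresOfSize N s v = ∑Tuples N s (λ u → ∑Bits s (λ σ → extensionFailure u σ v))

extensionFailures : ∀ N k → Vec Bool (N * N) → ℕ
extensionFailures N k v = ∑[ s < k ] failuresOfSize N (toℕ s) v

∑Bits-extensionFailure : ∀ {N s} (u : Vec (Fin N) s) σ → let r = ∣ ∁ (support u) ∣ in
  2 ^ (s * r) * ∑Bits (N * N) (extensionFailure u σ) ≤ (2 ^ s ∸ 1) ^ r * 2 ^ (N * N)
∑Bits-extensionFailure {N} {s} u σ with unique? u
... | yes u! = ≤-reflexive (trans (cong (2 ^ (s * ∣ ∁ (support u) ∣) *_) (∑Bits-cong (N * N) (λ v → *-identityˡ _)))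
  (∑Bits-noExtension u σ (outsideOf u) u! (members-unique (∁ (support u))) (outsideOf-disjoint u)))
... | no  _  = ≤-trans (≤-reflexive (trans (cong (2 ^ (s * ∣ ∁ (support u) ∣) *_) (∑Bits-zero (N * N)))
                                           (*-zeroʳ (2 ^ (s * ∣ ∁ (support u) ∣))))) z≤n

∑Bits-failuresOfSize : ∀ N s c → (∀ r → N ∸ s ≤ r → c * (2 ^ s ∸ 1) ^ r ≤ 2 ^ (s * r)) →
  c * ∑Bits (N * N) (failuresOfSize N s) ≤ (2 * N) ^ s * 2 ^ (N * N)
∑Bits-failuresOfSize N s c survives = begin
  c * ∑Bits m (failuresOfSize N s)
    ≡⟨ cong (c *_) (trans (∑Bits-comm-∑Tuples m N s _) (∑Tuples-cong N s (λ u → ∑Bits-comm m s _))) ⟩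
  c * ∑Tuples N s (λ u → ∑Bits s (λ σ → ∑Bits m (extensionFailure u σ)))
    ≤⟨ ∑Tuples-bound N s {c} _ (λ u → ∑Bits-bound s {c} _ (failure-bound u)) ⟩
  N ^ s * (2 ^ s * 2 ^ m)
    ≡⟨ sym (*-assoc (N ^ s) (2 ^ s) _) ⟩
  N ^ s * 2 ^ s * 2 ^ m
    ≡⟨ cong (_* 2 ^ m) (trans (*-comm (N ^ s) (2 ^ s)) (sym (^-distrib-* 2 N s))) ⟩
  (2 * N) ^ s * 2 ^ m ∎
  where
  open ≤-Reasoning
  m = N * N
  failure-bound : ∀ u σ → c * ∑Bits m (extensionFailure u σ) ≤ 2 ^ m
  failure-bound u σ = *-cancelˡ-≤ (2 ^ (s * r)) {{>-nonZero (m^n>0 2 (s * r))}} (begin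
    2 ^ (s * r) * (c * ∑Bits m (extensionFailure u σ))  ≡⟨ x∙yz≈y∙xz (2 ^ (s * r)) c _ ⟩
    c * (2 ^ (s * r) * ∑Bits m (extensionFailure u σ))  ≤⟨ *-monoʳ-≤ c (∑Bits-extensionFailure u σ) ⟩
    c * ((2 ^ s ∸ 1) ^ r * 2 ^ m)                       ≡⟨ sym (*-assoc c _ (2 ^ m)) ⟩
    c * (2 ^ s ∸ 1) ^ r * 2 ^ m                         ≤⟨ *-monoˡ-≤ (2 ^ m) (survives r (N∸s≤∣outsideOf∣ u)) ⟩
    2 ^ (s * r) * 2 ^ m                                 ∎)
    where r = ∣ ∁ (support u) ∣

∑Bits-failuresOfSize-0 : ∀ N → 1 ≤ N → ∑Bits (N * N) (failuresOfSize N 0) ≡ 0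
∑Bits-failuresOfSize-0 N 1≤N = n≤0⇒n≡0 (begin
  ∑Bits m (extensionFailure {N} [] [])                 ≡⟨ sym (*-identityˡ _) ⟩
  2 ^ (0 * r) * ∑Bits m (extensionFailure {N} [] [])   ≤⟨ ∑Bits-extensionFailure {N} [] [] ⟩
  0 ^ r * 2 ^ m                                    ≡⟨ cong (λ r → 0 ^ r * 2 ^ m) r≡N ⟩
  0 ^ N * 2 ^ m                                    ≡⟨ cong (_* 2 ^ m) (0^N≡0 1≤N) ⟩
  0                                                ∎)
  where
  open ≤-Reasoning
  m = N * N
  r = ∣ ∁ (⊥ {N}) ∣
  r≡N : r ≡ N
  r≡N = trans (∣∁p∣≡n∸∣p∣ (⊥ {N})) (cong (N ∸_) (∣⊥∣≡0 N))
  0^N≡0 : ∀ {N} → 1 ≤ N → 0 ^ N ≡ 0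
  0^N≡0 (s≤s _) = refl

adjacency-realises : ∀ {N s} (v : Vec Bool (N * N)) {z} (u : Vec (Fin N) s) (c : Fin N → Bool) → All (z ≢_) u →
  map c u ≡ select (map (pairIndex z) u) v → ∀ {x} → x ∈ᵥ u → adjacency v z x ≡ c x
adjacency-realises v (y ∷ u) c (z≢y ∷ _)   cu≡ (Any.here refl) = trans (adjacency-≢ v z≢y) (sym (∷-injectiveˡ cu≡))
adjacency-realises v (y ∷ u) c (_   ∷ z∉u) cu≡ (Any.there x∈u) = adjacency-realises v u c z∉u (∷-injectiveʳ cu≡) x∈u

extensionFailures≡0⇒EA : ∀ N k v → extensionFailures N k v ≡ 0 → EA k (graphOf N v)
extensionFailures≡0⇒EA N k v no-failures X Y X∩Y≡∅ ∣X∪Y∣<k = z , z∉S , adj-X , adj-Y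
  where
  S = X ∪ Y
  u = members S
  inX : Fin N → Bool
  inX x = does (x ∈? X)
  σ = map inX u
  failure≤0 : extensionFailure u σ v ≤ 0
  failure≤0 = ≤-trans (term≤∑Bits ∣ S ∣ _ σ) (≤-trans (term≤∑Tuples N ∣ S ∣ _ u)
                (≤-trans (term≤∑-toℕ k (λ s → failuresOfSize N s v) ∣X∪Y∣<k) (≤-reflexive no-failures)))
  noExtension≡0′ : noExtension u σ (outsideOf u) v ≡ 0
  noExtension≡0′ = n≤0⇒n≡0 (subst (_≤ 0) (*-identityˡ _)
    (subst (λ b → (if b then 1 else 0) * noExtension u σ (outsideOf u) v ≤ 0)
           (dec-true (unique? u) (members-unique S)) failure≤0))
  witness = noExtension≡0 u σ (outsideOf u) v noExtension≡0′
  z = Any.lookup witness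
  z∉u : All (z ≢_) u
  z∉u = proj₁ (All.lookupAny (outsideOf-disjoint u) witness)
  adjacency-S : ∀ {x} → x ∈ S → adjacency v z x ≡ inX x
  adjacency-S x∈S = adjacency-realises v u inX z∉u (proj₂ (All.lookupAny (outsideOf-disjoint u) witness)) (∈-members S x∈S)
  z∉S : z ∉ S
  z∉S z∈S = All.lookup z∉u (∈-members S z∈S) refl
  adj-X : ∀ x → x ∈ X → adjacency v z x ≡ true
  adj-X x x∈X = trans (adjacency-S (x∈p∪q⁺ (inj₁ x∈X))) (dec-true (x ∈? X) x∈X)
  adj-Y : ∀ y → y ∈ Y → adjacency v z y ≡ false
  adj-Y y y∈Y = trans (adjacency-S (x∈p∪q⁺ (inj₂ y∈Y))) (dec-false (y ∈? X) (λ y∈X → X∩Y≡∅ y y∈X y∈Y))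

-- The random graph

halve : ∀ n → ∃ λ h → 2 * h ≤ n × n ≤ suc (2 * h)
halve zero          = 0 , z≤n , z≤n
halve (suc zero)    = 0 , z≤n , s≤s z≤n
halve (suc (suc n)) = let h , 2h≤n , n≤1+2h = halve n in
  suc h , ≤-trans (≤-reflexive (*-suc 2 h)) (s≤s (s≤s 2h≤n)) , ≤-trans (s≤s (s≤s n≤1+2h)) (≤-reflexive (cong suc (sym (*-suc 2 h))))

split-exponent : ∀ ℓ k → 2 ≤ ℓ → ℓ ^ 4 ≤ 2 ^ (ℓ + 4 ∸ 2 * k) → ∃ λ D → ℓ ≡ 2 * k + D × ℓ ^ 4 ≤ 2 ^ (D + 4)
split-exponent ℓ k 2≤ℓ ℓ⁴≤ with 2 * k ≤? ℓ
... | yes 2k≤ℓ = ℓ ∸ 2 * k , sym (m+[n∸m]≡n 2k≤ℓ) , subst (λ e → ℓ ^ 4 ≤ 2 ^ e) (+-∸-comm 4 2k≤ℓ) ℓ⁴≤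
... | no  2k≰ℓ = contradiction ℓ⁴≤ (<⇒≱ (begin-strict
  2 ^ (ℓ + 4 ∸ 2 * k)   ≤⟨ ^-monoʳ-≤ 2 (∸-monoʳ-≤ (ℓ + 4) ℓ+1≤2k) ⟩
  2 ^ (ℓ + 4 ∸ suc ℓ)   ≡⟨ cong (2 ^_) (trans (cong (_∸ suc ℓ) (+-comm ℓ 4)) (m+n∸n≡m 3 (suc ℓ))) ⟩
  8                     <⟨ s≤s (s≤s (s≤s (s≤s (s≤s (s≤s (s≤s (s≤s (s≤s z≤n)))))))) ⟩
  2 ^ 4                 ≤⟨ ^-monoˡ-≤ 4 2≤ℓ ⟩
  ℓ ^ 4                 ∎))
  where
  open ≤-Reasoning
  ℓ+1≤2k : suc ℓ ≤ 2 * k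
  ℓ+1≤2k = ≰⇒> 2k≰ℓ

fourth-root : ∀ {h ℓ D} → 2 * h ≤ ℓ → ℓ ^ 4 ≤ 2 ^ (D + 4) → h * h * (h * h) ≤ 2 ^ D
fourth-root {h} {ℓ} {D} 2h≤ℓ ℓ⁴≤ = *-cancelˡ-≤ 16 (begin
  16 * (h * h * (h * h))   ≡⟨ expand h ⟩
  (2 * h) ^ 4              ≤⟨ ^-monoˡ-≤ 4 2h≤ℓ ⟩
  ℓ ^ 4                    ≤⟨ ℓ⁴≤ ⟩
  2 ^ (D + 4)              ≡⟨ trans (^-distribˡ-+-* 2 D 4) (*-comm (2 ^ D) 16) ⟩
  16 * 2 ^ D               ∎)
  where
  open ≤-Reasoning
  expand : ∀ h → 16 * (h * h * (h * h)) ≡ 2 * h * (2 * h * (2 * h * (2 * h * 1)))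
  expand = solve-∀

extension-exponent : ∀ k′ d h → 2 * k′ + 5 + d ≤ 2 * h →
  4 + (suc k′ + suc k′) + (2 + (2 * k′ + (4 + d))) * k′ ≤ h * h + h * h
extension-exponent k′ d h L≤2h = *-cancelˡ-≤ 2 (begin
  2 * E                          ≤⟨ m≤m+n (2 * E) slack ⟩
  2 * E + slack                  ≡⟨ complete-square k′ d ⟩
  L * L                          ≤⟨ *-mono-≤ L≤2h L≤2h ⟩
  2 * h * (2 * h)                ≡⟨ double h ⟩
  2 * (h * h + h * h)            ∎)
  where
  open ≤-Reasoning
  E = 4 + (suc k′ + suc k′) + (2 + (2 * k′ + (4 + d))) * k′
  L = 2 * k′ + 5 + d
  slack = 4 * k′ + 13 + d * d + 2 * d * k′ + 10 * d
  complete-square : ∀ k′ d →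
    2 * (4 + (suc k′ + suc k′) + (2 + (2 * k′ + (4 + d))) * k′) + (4 * k′ + 13 + d * d + 2 * d * k′ + 10 * d)
      ≡ (2 * k′ + 5 + d) * (2 * k′ + 5 + d)
  complete-square = solve-∀
  double : ∀ h → 2 * h * (2 * h) ≡ 2 * (h * h + h * h)
  double = solve-∀

module RandomGraph (F : Graph) (k′ D h : ℕ) (ℓ≡2k+D : n F ≡ 2 * suc k′ + D)
                   (h⁴≤2^D : h * h * (h * h) ≤ 2 ^ D) (ℓ≤2h+1 : n F ≤ suc (2 * h)) where

  k = suc k′
  N = 2 ^ k′ * (h * h)
  m = N * N

  ℓ≡2+[2k′+D] : n F ≡ 2 + (2 * k′ + D)
  ℓ≡2+[2k′+D] = trans ℓ≡2k+D (regroup k′ D)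
    where
    regroup : ∀ k′ D → 2 * suc k′ + D ≡ 2 + (2 * k′ + D)
    regroup = solve-∀

  1≤h : 1 ≤ h
  1≤h = n≢0⇒n>0 λ h≡0 → <⇒≱ 2≤ℓ (subst (λ h → n F ≤ suc (2 * h)) h≡0 ℓ≤2h+1)
    where
    2≤ℓ : 2 ≤ n F
    2≤ℓ = subst (2 ≤_) (sym ℓ≡2+[2k′+D]) (m≤m+n 2 _)

  1≤N : 1 ≤ N
  1≤N = *-mono-≤ (m^n>0 2 k′) (*-mono-≤ 1≤h 1≤h)

  N²≤2^[2k′+D] : N * N ≤ 2 ^ (2 * k′ + D)
  N²≤2^[2k′+D] = begin
    N * N                                   ≡⟨ *-interchange (2 ^ k′) (h * h) (2 ^ k′) (h * h) ⟩
    2 ^ k′ * 2 ^ k′ * (h * h * (h * h))     ≤⟨ *-monoʳ-≤ (2 ^ k′ * 2 ^ k′) h⁴≤2^D ⟩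
    2 ^ k′ * 2 ^ k′ * 2 ^ D                 ≡⟨ cong (_* 2 ^ D) (sym (^-distribˡ-+-* 2 k′ k′)) ⟩
    2 ^ (k′ + k′) * 2 ^ D                   ≡⟨ sym (^-distribˡ-+-* 2 (k′ + k′) D) ⟩
    2 ^ (k′ + k′ + D)                       ≡⟨ cong (λ e → 2 ^ (k′ + e + D)) (sym (+-identityʳ k′)) ⟩
    2 ^ (2 * k′ + D)                        ∎
    where open ≤-Reasoning

  copies allFailures : ℕ
  copies      = ∑Bits m (inducedCopies N (n F) (adj F))
  allFailures = ∑Bits m (extensionFailures N k)

  2*copies≤2^m : 2 * copies ≤ 2 ^ m
  2*copies≤2^m = *-cancelˡ-≤ (2 ^ P) {{>-nonZero (m^n>0 2 P)}} (begin
    2 ^ P * (2 * copies)         ≡⟨ x∙yz≈y∙xz (2 ^ P) 2 copies ⟩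
    2 * (2 ^ P * copies)         ≤⟨ *-monoʳ-≤ 2 (∑Bits-inducedCopies N (n F) (adj F)) ⟩
    2 * (N ^ n F * 2 ^ m)        ≡⟨ sym (*-assoc 2 (N ^ n F) (2 ^ m)) ⟩
    2 * N ^ n F * 2 ^ m          ≤⟨ *-monoˡ-≤ (2 ^ m) 2*N^ℓ≤2^P ⟩
    2 ^ P * 2 ^ m                ∎)
    where
    open ≤-Reasoning
    P = choose2 (n F)
    2*N^ℓ≤2^P : 2 * N ^ n F ≤ 2 ^ P
    2*N^ℓ≤2^P = subst (λ ℓ → 2 * N ^ ℓ ≤ 2 ^ choose2 ℓ) (sym ℓ≡2+[2k′+D]) (2*N^ℓ≤2^choose2ℓ N (2 * k′ + D) N²≤2^[2k′+D])

  X = 2 * k * (2 * N) ^ k′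

  2≤h : 1 ≤ k′ → 2 ≤ h
  2≤h 1≤k′ = ≮⇒≥ λ h<2 → <⇒≱ 3≤2h (*-monoʳ-≤ 2 (≤-pred h<2))
    where
    open ≤-Reasoning
    3≤2h : 3 ≤ 2 * h
    3≤2h = ≤-pred (begin
      4                 ≤⟨ *-monoʳ-≤ 2 (s≤s 1≤k′) ⟩
      2 * suc k′        ≤⟨ m≤m+n _ D ⟩
      2 * suc k′ + D    ≡⟨ ℓ≡2k+D ⟨
      n F               ≤⟨ ℓ≤2h+1 ⟩
      suc (2 * h)       ∎)

  4≤D : 1 ≤ k′ → 4 ≤ D
  4≤D 1≤k′ = ≮⇒≥ λ D<4 → <⇒≱ (^-monoʳ-< 2 (s≤s (s≤s z≤n)) D<4) (begin
    2 ^ 4                 ≤⟨ ^-monoˡ-≤ 4 (2≤h 1≤k′) ⟩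
    h ^ 4                 ≡⟨ fourth h ⟩
    h * h * (h * h)       ≤⟨ h⁴≤2^D ⟩
    2 ^ D                 ∎)
    where
    open ≤-Reasoning
    fourth : ∀ h → h * (h * (h * (h * 1))) ≡ h * h * (h * h)
    fourth = solve-∀

  X-exponent : 1 ≤ k′ → 4 + (k + k) + (2 + (2 * k′ + D)) * k′ ≤ h * h + h * h
  X-exponent 1≤k′ = subst (λ D → 4 + (k + k) + (2 + (2 * k′ + D)) * k′ ≤ h * h + h * h) D≡4+d
    (extension-exponent k′ d h (≤-pred (begin
      suc (2 * k′ + 5 + d)     ≡⟨ regroup k′ d ⟩
      2 * suc k′ + (4 + d)     ≡⟨ cong (2 * suc k′ +_) D≡4+d ⟩
      2 * suc k′ + D           ≡⟨ ℓ≡2k+D ⟨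
      n F                      ≤⟨ ℓ≤2h+1 ⟩
      suc (2 * h)              ∎)))
    where
    open ≤-Reasoning
    d = D ∸ 4
    D≡4+d : 4 + d ≡ D
    D≡4+d = m+[n∸m]≡n (4≤D 1≤k′)
    regroup : ∀ k′ d → suc (2 * k′ + 5 + d) ≡ 2 * suc k′ + (4 + d)
    regroup = solve-∀

  2X≤2^[h*h] : 1 ≤ k′ → 2 * X ≤ 2 ^ (h * h)
  2X≤2^[h*h] 1≤k′ = square-cancel-≤ (begin
    2 * X * (2 * X)                                 ≡⟨ regroup k A ⟩
    2 ^ 4 * (k * k) * (A * A)                        ≤⟨ *-mono-≤ (*-monoʳ-≤ (2 ^ 4) k²≤2^[k+k]) A²≤2^E ⟩
    2 ^ 4 * 2 ^ (k + k) * 2 ^ E                      ≡⟨ cong (_* 2 ^ E) (sym (^-distribˡ-+-* 2 4 (k + k))) ⟩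
    2 ^ (4 + (k + k)) * 2 ^ E                        ≡⟨ sym (^-distribˡ-+-* 2 (4 + (k + k)) E) ⟩
    2 ^ (4 + (k + k) + E)                            ≤⟨ ^-monoʳ-≤ 2 (X-exponent 1≤k′) ⟩
    2 ^ (h * h + h * h)                              ≡⟨ ^-distribˡ-+-* 2 (h * h) (h * h) ⟩
    2 ^ (h * h) * 2 ^ (h * h)                        ∎)
    where
    open ≤-Reasoning
    A = (2 * N) ^ k′
    E = (2 + (2 * k′ + D)) * k′
    regroup : ∀ k A → 2 * (2 * k * A) * (2 * (2 * k * A)) ≡ 16 * (k * k) * (A * A)
    regroup = solve-∀
    k²≤2^[k+k] : k * k ≤ 2 ^ (k + k)
    k²≤2^[k+k] = ≤-trans (*-mono-≤ (<⇒≤ (n<2^n k)) (<⇒≤ (n<2^n k))) (≤-reflexive (sym (^-distribˡ-+-* 2 k k)))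
    [2N]²≤ : 2 * N * (2 * N) ≤ 2 ^ (2 + (2 * k′ + D))
    [2N]²≤ = begin
      2 * N * (2 * N)                 ≡⟨ *-interchange 2 N 2 N ⟩
      2 ^ 2 * (N * N)                 ≤⟨ *-monoʳ-≤ (2 ^ 2) N²≤2^[2k′+D] ⟩
      2 ^ 2 * 2 ^ (2 * k′ + D)        ≡⟨ sym (^-distribˡ-+-* 2 2 (2 * k′ + D)) ⟩
      2 ^ (2 + (2 * k′ + D))          ∎
    A²≤2^E : A * A ≤ 2 ^ E
    A²≤2^E = begin
      A * A                           ≡⟨ sym (^-distrib-* (2 * N) (2 * N) k′) ⟩
      (2 * N * (2 * N)) ^ k′          ≤⟨ ^-monoˡ-≤ k′ [2N]²≤ ⟩
      (2 ^ (2 + (2 * k′ + D))) ^ k′   ≡⟨ ^-*-assoc 2 (2 + (2 * k′ + D)) k′ ⟩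
      2 ^ E                           ∎

  X*[2^s∸1]^r≤2^[s*r] : ∀ s → 1 ≤ s → s ≤ k′ → ∀ r → N ∸ s ≤ r → X * (2 ^ s ∸ 1) ^ r ≤ 2 ^ (s * r)
  X*[2^s∸1]^r≤2^[s*r] s 1≤s s≤k′ r N∸s≤r = subst (X * (2 ^ s ∸ 1) ^ r ≤_) (^-*-assoc 2 s r)
    (survival (m^n>0 2 s) (^-monoʳ-≤ 2 s≤k′) qM≤r X≤2^M)
    where
    open ≤-Reasoning
    M = h * h ∸ 1
    qM≤r : 2 ^ k′ * M ≤ r
    qM≤r = begin
      2 ^ k′ * (h * h ∸ 1)       ≡⟨ *-distribˡ-∸ (2 ^ k′) (h * h) 1 ⟩
      N ∸ 2 ^ k′ * 1             ≤⟨ ∸-monoʳ-≤ N (≤-trans (<⇒≤ (≤-trans (n<2^n s) (^-monoʳ-≤ 2 s≤k′))) (≤-reflexive (sym (*-identityʳ _)))) ⟩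
      N ∸ s                      ≤⟨ N∸s≤r ⟩
      r                          ∎
    X≤2^M : X ≤ 2 ^ M
    X≤2^M = *-cancelˡ-≤ 2 (begin
      2 * X                      ≤⟨ 2X≤2^[h*h] (≤-trans 1≤s s≤k′) ⟩
      2 ^ (h * h)                ≡⟨ cong (2 ^_) (sym (m∸n+n≡m (*-mono-≤ 1≤h 1≤h))) ⟩
      2 ^ (M + 1)                ≡⟨ trans (^-distribˡ-+-* 2 M 1) (*-comm (2 ^ M) 2) ⟩
      2 * 2 ^ M                  ∎)

  failures : ℕ → ℕ
  failures s = ∑Bits m (failuresOfSize N s)

  2k*failures≤2^m : ∀ s → 1 ≤ s → s ≤ k′ → 2 * k * failures s ≤ 2 ^ m
  2k*failures≤2^m s 1≤s s≤k′ = *-cancelˡ-≤ ((2 * N) ^ k′) {{>-nonZero (m^n>0 (2 * N) {{>-nonZero 0<2N}} k′)}} (begin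
    (2 * N) ^ k′ * (2 * k * failures s)   ≡⟨ x∙yz≈y∙xz ((2 * N) ^ k′) (2 * k) (failures s) ⟩
    2 * k * ((2 * N) ^ k′ * failures s)   ≡⟨ sym (*-assoc (2 * k) ((2 * N) ^ k′) (failures s)) ⟩
    X * failures s                        ≤⟨ ∑Bits-failuresOfSize N s X (X*[2^s∸1]^r≤2^[s*r] s 1≤s s≤k′) ⟩
    (2 * N) ^ s * 2 ^ m                   ≤⟨ *-monoˡ-≤ (2 ^ m) (^-monoʳ-≤ (2 * N) {{>-nonZero 0<2N}} s≤k′) ⟩
    (2 * N) ^ k′ * 2 ^ m                  ∎)
    where
    open ≤-Reasoning
    0<2N : 0 < 2 * N
    0<2N = *-mono-≤ (s≤s (z≤n {1})) 1≤N

  2*allFailures<2^m : 2 * allFailures < 2 ^ m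
  2*allFailures<2^m = *-cancelˡ-< k (2 * allFailures) (2 ^ m) (begin-strict
    k * (2 * allFailures)                       ≡⟨ cong (λ x → k * (2 * x)) (∑Bits-comm-∑ m k (λ v s → failuresOfSize N (toℕ s) v)) ⟩
    k * (2 * total)                             ≡⟨ x∙yz≈y∙xz k 2 total ⟩
    2 * (k * total)                             ≡⟨ sym (*-assoc 2 k total) ⟩
    2 * k * (failures 0 + rest)                 ≡⟨ cong (λ f₀ → 2 * k * (f₀ + rest)) (∑Bits-failuresOfSize-0 N 1≤N) ⟩
    2 * k * rest                                ≡⟨ *-distribˡ-sum {k′} (2 * k) (λ s → failures (suc (toℕ s))) ⟩
    ∑[ s < k′ ] (2 * k * failures (suc (toℕ s))) ≤⟨ ∑-mono-≤ k′ (λ s → 2k*failures≤2^m (suc (toℕ s)) (s≤s z≤n) (toℕ<n s)) ⟩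
    ∑[ s < k′ ] (2 ^ m)                         ≡⟨ ∑-const k′ (2 ^ m) ⟩
    k′ * 2 ^ m                                  <⟨ *-monoˡ-< (2 ^ m) {{>-nonZero (m^n>0 2 m)}} (n<1+n k′) ⟩
    k * 2 ^ m                                   ∎)
    where
    open ≤-Reasoning
    total = ∑[ s < k ] failures (toℕ s)
    rest = ∑[ s < k′ ] failures (suc (toℕ s))

  bad : Vec Bool m → ℕ
  bad v = inducedCopies N (n F) (adj F) v + extensionFailures N k v

  good-bits : ∃ λ v → bad v ≡ 0
  good-bits = ∑Bits<2^m⇒zero m bad (*-cancelˡ-< 2 (∑Bits m bad) (2 ^ m) (begin-strict
    2 * ∑Bits m bad               ≡⟨ cong (2 *_) (∑Bits-distrib-+ m (inducedCopies N (n F) (adj F)) (extensionFailures N k)) ⟩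
    2 * (copies + allFailures)    ≡⟨ *-distribˡ-+ 2 copies allFailures ⟩
    2 * copies + 2 * allFailures  <⟨ +-mono-≤-< 2*copies≤2^m 2*allFailures<2^m ⟩
    2 ^ m + 2 ^ m                 ≡⟨ cong (2 ^ m +_) (sym (+-identityʳ (2 ^ m))) ⟩
    2 * 2 ^ m                     ∎))
    where open ≤-Reasoning

  good-graph : Σ Graph λ H → EA k H × ¬ F ⊏ H
  good-graph = let v , bad≡0 = good-bits in
    graphOf N v ,
    extensionFailures≡0⇒EA N k v (m+n≡0⇒n≡0 (inducedCopies N (n F) (adj F) v) bad≡0) ,
    inducedCopies≡0⇒⋢ N F v (m+n≡0⇒m≡0 _ bad≡0)

EA-graph-omitting : ∀ F → 2 ≤ n F → ∀ k′ → n F ^ 4 ≤ 2 ^ (n F + 4 ∸ 2 * suc k′) →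
  Σ Graph λ H → EA (suc k′) H × ¬ F ⊏ H
EA-graph-omitting F 2≤ℓ k′ ℓ⁴≤ =
  let D , ℓ≡2k+D , ℓ⁴≤2^[D+4] = split-exponent (n F) (suc k′) 2≤ℓ ℓ⁴≤
      h , 2h≤ℓ , ℓ≤2h+1       = halve (n F)
  in RandomGraph.good-graph F k′ D h ℓ≡2k+D (fourth-root {h} {n F} {D} 2h≤ℓ ℓ⁴≤2^[D+4]) ℓ≤2h+1

lemma3p5 : (F : Graph) → 2 ≤ n F →
    (k : ℕ) → 1 ≤ k → ForcesF F k → FloorBoundLe (n F) k
lemma3p5 F 2≤ℓ (suc k′) _ forces with 2 ^ (n F + 4 ∸ 2 * suc k′) <? n F ^ 4
... | yes bound = bound
... | no ¬bound = let H , EA-H , F⋢H = EA-graph-omitting F 2≤ℓ k′ (≮⇒≥ ¬bound) in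
  contradiction (forces H EA-H) F⋢H
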